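{- For compositions of operators $\mathbf v,\mathbf v'$: (a) $\mathbf v\equiv\mathbf 0$ if and only if $\rho(\mathbf v)\equiv\mathbf 0$; (b) $\mathbf v\equiv\mathbf v'$ if and only if $\rho(\mathbf v)\equiv\rho(\mathbf v')$.
   Context: For a positive integer $N$, $[N]=\{1,\dots,N\}$, $S_N$ is the symmetric group on $[N]$, $s_{ab}$ the transposition exchanging $a,b$, $\ell$ the number of inversions. With commuting indeterminates $q_1,\dots,q_{N-1}$, $\mathbf q^\alpha=\prod q_i^{\alpha_i}$, $\mathbf q_{ij}=q_i\cdots q_{j-1}$ ($i<j$), $S_N[\mathbf q]=\{\mathbf q^\alpha w\}$, $\ell(\mathbf q^\alpha w)=\ell(w)+2\deg\mathbf q^\alpha$. For $k\in[N-1]$ the quantum $k$-Bruhat order has covers, for $w\in S_N$ and $i\le k<j$: $w\lessdot_k ws_{ij}$ if $\ell(ws_{ij})=\ell(w)+1$, $w\lessdot_k\mathbf q_{ij}ws_{ij}$ if $\ell(\mathbf q_{ij}ws_{ij})=\ell(w)+1$; extended $\mathbf q$-multiplicatively. Operators $\mathbf v_{ab}$ ($a\neq b$ positive integers) generate a free monoid, with zero element $\mathbf 0$; a composition $\mathbf v_{a_rb_r}\cdots\mathbf v_{a_1b_1}$ has support $\{a_1,b_1,\dots,a_r,b_r\}$. For support in $[N]$, $k\in[N-1]$, $u\in S_N$: $\mathbf v_{ab}\bullet_ku=s_{ab}u$ if $a<b$ and $u\lessdot_ks_{ab}u$; $=\mathbf q_{ij}s_{ab}u$ if $a>b$, $i=u^{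 -1}(a)$, $j=u^{ -1}(b)$ and $u\lessdot_k\mathbf q_{ij}s_{ab}u$; $=0$ otherwise; extended by $\mathbf v\bullet_k(\mathbf q^\alpha u)=\mathbf q^\alpha(\mathbf v\bullet_ku)$, $\bullet_k0=0$, compositions acting rightmost operator first. $\mathbf v\equiv\mathbf v'$ means $\mathbf v\bullet_kx=\mathbf v'\bullet_kx$ for all $N$ with both supports in $[N]$, all $x\in S_N[\mathbf q]$, $k\in[N-1]$; $\mathbf v\equiv\mathbf 0$ means the action is always $0$. Vertical flip: $\rho(\mathbf v_{a_rb_r}\cdots\mathbf v_{a_1b_1})=\mathbf v_{a_1b_1}\cdots\mathbf v_{a_rb_r}$. -}

module Defs where

open import Data.Nat using (ℕ; zero; suc; _+_; _*_; _∸_; _≤_; _<_; _≡ᵇ_; _<ᵇ_; _≤ᵇ_)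
import Data.Nat as ℕ
open import Data.Bool using (Bool; true; false; if_then_else_; _∧_; _∨_)
open import Data.List as List using (List; []; _∷_; upTo; reverse; filter)
open import Data.Bool.ListAction using (any)
open import Data.Nat.ListAction using (sum)
open import Data.List.Relation.Unary.All using (All)
open import Data.List.Relation.Unary.Unique.Propositional using (Unique)
open import Data.Vec as Vec using (Vec; toList; replicate; zipWith; tabulate)
open import Data.Vec.Properties using (≡-dec)
open import Data.Fin using (Fin; toℕ)
open import Data.Maybe using (Maybe; just; nothing; _>>=_)
open import Data.Product using (_×_; _,_)
open import Relation.Nullary using (¬_)
open import Relation.Nullary.Decidable using (⌊_⌋)
open import Relation.Binary.PropositionalEquality using (_≡_; _≢_)

-- Everything is 1-based, as in the paper.
-- A permutation w ∈ S_N is stored in one-line notation as a vector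
-- (w(1), …, w(N)) of naturals; it is a permutation iff all entries lie in
-- [N] and are pairwise distinct.
-- A monomial q^α in q_1,…,q_{N-1} is stored as its exponent vector
-- α ∈ ℕ^{N-1}: entry number m (0-based Fin index) is the exponent of q_{m+1}.
-- An element q^α w of S_N[q] is the pair (α , w).

Word : ℕ → Set
Word N = Vec ℕ N

Exps : ℕ → Set
Exps N = Vec ℕ (N ∸ 1)

QPerm : ℕ → Set
QPerm N = Exps N × Word N

IsPerm : (N : ℕ) → Word N → Set
IsPerm N w = All (λ x → 1 ≤ x × x ≤ N) (toList w) × Unique (toList w)

-- 1-based entry of a list (0 if out of range; never used out of range)
nth : List ℕ → ℕ → ℕ
nth []       _             = 0
nth (x ∷ xs) zero          = 0
nth (x ∷ xs) (suc zero)    = x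
nth (x ∷ xs) (suc (suc i)) = nth xs (suc i)

val : ∀ {N} → Word N → ℕ → ℕ
val w i = nth (toList w) i

-- 1-based position of a value in a list (0 if absent): w⁻¹(a)
posL : ℕ → List ℕ → ℕ
posL a []       = 0
posL a (x ∷ xs) = if x ≡ᵇ a then 1 else (if posL a xs ≡ᵇ 0 then 0 else suc (posL a xs))

inv : ∀ {N} → Word N → ℕ → ℕ
inv w a = posL a (toList w)

-- s_ab w : left multiplication by the transposition s_ab (exchange values a,b)
swapVals : ∀ {N} → ℕ → ℕ → Word N → Word N
swapVals a b w = Vec.map (λ x → if x ≡ᵇ a then b else (if x ≡ᵇ b then a else x)) w

-- w s_ij : right multiplication by s_ij (exchange positions i,j)
swapPos : ∀ {N} → ℕ → ℕ → Word N → Word N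
swapPos {N} i j w =
  tabulate (λ (p : Fin N) →
    let p′ = suc (toℕ p) in
    if p′ ≡ᵇ i then val w j else (if p′ ≡ᵇ j then val w i else Vec.lookup w p))

invsL : List ℕ → ℕ
invsL []       = 0
invsL (x ∷ xs) = List.length (filter (λ y → y ℕ.<? x) xs) + invsL xs

len : ∀ {N} → Word N → ℕ
len w = invsL (toList w)

deg : (N : ℕ) → Exps N → ℕ
deg N α = sum (toList α)

qlen : (N : ℕ) → QPerm N → ℕ
qlen N (α , w) = len w + 2 * deg N α

zeroE : (N : ℕ) → Exps N
zeroE N = replicate (N ∸ 1) 0

-- exponent vector of q_ij = q_i q_{i+1} ⋯ q_{j-1}  (meaningful for i < j)
qE : (N : ℕ) → ℕ → ℕ → Exps N
qE N i j = tabulate (λ m → if (i ≤ᵇ suc (toℕ m)) ∧ (suc (toℕ m) <ᵇ j) then 1 else 0)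

_=ᵉ_ : ∀ {n} → Vec ℕ n → Vec ℕ n → Bool
x =ᵉ y = ⌊ ≡-dec ℕ._≟_ x y ⌋

range : ℕ → ℕ → List ℕ
range s t = List.map (λ m → suc (s + m)) (upTo (t ∸ s))

-- Cover relation of the quantum k-Bruhat order, from u ∈ S_N to y ∈ S_N[q]:
-- there are i ≤ k < j (in [N]) with
--   y = u s_ij          and ℓ(u s_ij) = ℓ(u) + 1, or
--   y = q_ij u s_ij     and ℓ(q_ij u s_ij) = ℓ(u) + 1.
covers : (N k : ℕ) → Word N → QPerm N → Bool
covers N k u (β , w) =
  any (λ i → any (λ j →
        (w =ᵉ swapPos i j u) ∧
        (((β =ᵉ zeroE N) ∧ (len w ≡ᵇ suc (len u)))
         ∨ ((β =ᵉ qE N i j) ∧ (qlen N (β , w) ≡ᵇ suc (len u)))))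
      (range k N))
    (range 0 k)

record Op : Set where
  constructor v[_,_]
  field
    a b  : ℕ
    {a≢b} : a ≢ b
    {a>0} : 1 ≤ a
    {b>0} : 1 ≤ b
open Op public

-- The composition v_{a_r b_r} ⋯ v_{a_1 b_1} is the list
-- (v_{a_r b_r} ∷ … ∷ v_{a_1 b_1} ∷ []), written left to right as in the paper.
Comp : Set
Comp = List Op

ρ : Comp → Comp
ρ = reverse

SuppIn : ℕ → Comp → Set
SuppIn N v = All (λ o → a o ≤ N × b o ≤ N) v

-- action of a single operator on q^α u  (nothing = 0)
step : (N k : ℕ) → Op → QPerm N → Maybe (QPerm N)
step N k o (α , u) =
  if a o <ᵇ b o
  then (if covers N k u (zeroE N , swapVals (a o) (b o) u)
        then just (α , swapVals (a o) (b o) u) else nothing)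
  else (let i = inv u (a o) ; j = inv u (b o) in
        if (i <ᵇ j) ∧ covers N k u (qE N i j , swapVals (a o) (b o) u)
        then just (zipWith _+_ α (qE N i j) , swapVals (a o) (b o) u) else nothing)

-- action of a composition (rightmost operator first); 0 is absorbing
act : (N k : ℕ) → Comp → QPerm N → Maybe (QPerm N)
act N k []      x = just x
act N k (o ∷ v) x = act N k v x >>= step N k o

_≋_ : Comp → Comp → Set
v ≋ v' = ∀ N → SuppIn N v → SuppIn N v' →
         ∀ (α : Exps N) (u : Word N) → IsPerm N u →
         ∀ k → 1 ≤ k → k < N →
         act N k v (α , u) ≡ act N k v' (α , u)

≋𝟎 : Comp → Set
≋𝟎 v = ∀ N → SuppIn N v →
       ∀ (α : Exps N) (u : Word N) → IsPerm N u →
       ∀ k → 1 ≤ k → k < N →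
       act N k v (α , u) ≡ nothing

-- Reversing one-line notation, w ↦ w w₀, turns the quantum k-Bruhat order into the quantum
-- (N − k)-Bruhat order read backwards: since ℓ(w w₀) = (N choose 2) − ℓ(w) and conjugation by w₀
-- sends s_ij to s_{N+1−j,N+1−i}, a cover u ⋖ₖ q^β u s_ij becomes u s_ij w₀ ⋖_{N−k} q^{β′} u w₀, where β′
-- reverses the exponent vector (q_m ↦ q_{N−m}).  Left multiplication by s_ab commutes with w ↦ w w₀, so
-- v •ₖ u = q^Δ y exactly when ρ(v) •_{N−k} y w₀ = q^{Δ′} u w₀.  As w ↦ w w₀ and k ↦ N − k are involutions,
-- the nonzero values of v and of ρ(v) determine each other, which gives (a) and (b); q-multiplicativity of
-- the action reduces everything to arguments u ∈ S_N.

module Submission where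

open import Defs
open import Data.Nat using (ℕ; zero; suc; _+_; _∸_; _≤_; _<_; _≡ᵇ_; _<ᵇ_; _≤ᵇ_; z≤n; s≤s)
import Data.Nat as ℕ
open import Data.Nat.Properties
open import Data.Nat.Combinatorics using (_C_; nC1≡n; nCk+nC[k+1]≡[n+1]C[k+1])
open import Data.Nat.ListAction using (sum)
open import Data.Nat.ListAction.Properties using (sum-↭)
open import Algebra.Properties.CommutativeSemigroup +-commutativeSemigroup using (interchange)
open import Data.Bool using (Bool; true; false; T; if_then_else_; _∧_; _∨_)
open import Data.Bool.Properties using (T-≡; T-∧; T-∨; ⇔→≡; ∧-comm)
open import Data.Bool.ListAction using (any)
open import Data.List as List using (List; []; _∷_; _++_)
import Data.List.Properties as List
open import Data.List.Membership.Propositional using (_∈_; find; lose)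
import Data.List.Membership.Propositional.Properties as ∈
open import Data.List.Relation.Unary.Any using (here; there)
open import Data.List.Relation.Unary.Any.Properties using (any⁺; any⁻)
open import Data.List.Relation.Unary.All as All using (All; []; _∷_)
import Data.List.Relation.Unary.All.Properties as All
open import Data.List.Relation.Unary.AllPairs using (_∷_)
open import Data.List.Relation.Unary.Unique.Propositional using (Unique)
import Data.List.Relation.Unary.Unique.Propositional.Properties as Unique
open import Data.List.Relation.Binary.Permutation.Propositional using (↭-sym; ↭⇒↭ₛ)
open import Data.List.Relation.Binary.Permutation.Propositional.Properties
  using (↭-reverse; ↭-length; filter-↭; All-resp-↭)
open import Data.Maybe as Maybe using (Maybe; just; nothing; _>>=_)
open import Data.Vec as Vec using (Vec; toList; tabulate; lookup)
import Data.Vec.Properties as Vec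
open import Data.Fin as Fin using (Fin; toℕ)
open import Data.Product using (_×_; _,_; Σ; proj₁; proj₂)
open import Data.Sum using (_⊎_; inj₁; inj₂)
open import Data.Empty using (⊥-elim)
open import Function using (_∘_)
open import Function.Bundles using (Equivalence; _⇔_; mk⇔)
open import Relation.Nullary using (Dec; yes; no; contradiction)
open import Relation.Nullary.Decidable using (toWitness; fromWitness)
open import Relation.Binary.PropositionalEquality
open import Data.List.Relation.Binary.Permutation.Setoid.Properties (setoid ℕ) using (Unique-resp-↭)

T⇒≡true : ∀ {b} → T b → b ≡ true
T⇒≡true = Equivalence.to T-≡

≡true⇒T : ∀ {b} → b ≡ true → T b
≡true⇒T = Equivalence.from T-≡

T⇔T⇒≡ : ∀ {b c : Bool} → (T b → T c) → (T c → T b) → b ≡ c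
T⇔T⇒≡ b⇒c c⇒b = ⇔→≡ {z = true} (mk⇔ (T⇒≡true ∘ b⇒c ∘ ≡true⇒T) (T⇒≡true ∘ c⇒b ∘ ≡true⇒T))

≡ᵇ-refl : ∀ n → (n ≡ᵇ n) ≡ true
≡ᵇ-refl n = T⇒≡true (≡⇒≡ᵇ n n refl)

≢⇒≡ᵇ-false : ∀ {m n} → m ≢ n → (m ≡ᵇ n) ≡ false
≢⇒≡ᵇ-false {m} {n} m≢n with m ≡ᵇ n in e
... | false = refl
... | true  = ⊥-elim (m≢n (≡ᵇ⇒≡ m n (≡true⇒T e)))

nth-∷ʳ-< : ∀ ys (x : ℕ) p → 1 ≤ p → p ≤ List.length ys → nth (ys ++ x ∷ []) p ≡ nth ys p
nth-∷ʳ-< (y ∷ ys) x (suc zero)    _ _       = refl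
nth-∷ʳ-< (y ∷ ys) x (suc (suc p)) _ (s≤s h) = nth-∷ʳ-< ys x (suc p) (s≤s z≤n) h

nth-∷ʳ-last : ∀ ys (x : ℕ) → nth (ys ++ x ∷ []) (suc (List.length ys)) ≡ x
nth-∷ʳ-last []            x = refl
nth-∷ʳ-last (y ∷ [])      x = refl
nth-∷ʳ-last (y ∷ y′ ∷ ys) x = nth-∷ʳ-last (y′ ∷ ys) x

nth-reverse : ∀ xs p → 1 ≤ p → p ≤ List.length xs →
              nth (List.reverse xs) p ≡ nth xs (suc (List.length xs) ∸ p)
nth-reverse []       (suc p) _ ()
nth-reverse (x ∷ xs) p 1≤p p≤ rewrite List.unfold-reverse x xs with m≤n⇒m<n∨m≡n p≤
... | inj₂ refl = begin
  nth (List.reverse xs ++ x ∷ []) (suc (List.length xs))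
    ≡⟨ cong (λ n → nth (List.reverse xs ++ x ∷ []) (suc n)) (List.length-reverse xs) ⟨
  nth (List.reverse xs ++ x ∷ []) (suc (List.length (List.reverse xs)))
    ≡⟨ nth-∷ʳ-last (List.reverse xs) x ⟩
  x
    ≡⟨ cong (nth (x ∷ xs)) (m+n∸n≡m 1 (List.length xs)) ⟨
  nth (x ∷ xs) (suc (suc (List.length xs)) ∸ suc (List.length xs)) ∎
  where open ≡-Reasoning
... | inj₁ (s≤s p≤n) = begin
  nth (List.reverse xs ++ x ∷ []) p
    ≡⟨ nth-∷ʳ-< (List.reverse xs) x p 1≤p (subst (p ≤_) (sym (List.length-reverse xs)) p≤n) ⟩
  nth (List.reverse xs) p
    ≡⟨ nth-reverse xs p 1≤p p≤n ⟩
  nth xs (suc n ∸ p)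
    ≡⟨ cong (nth xs) (+-∸-assoc 1 p≤n) ⟩
  nth (x ∷ xs) (suc (suc (n ∸ p)))
    ≡⟨ cong (nth (x ∷ xs)) (trans (+-∸-assoc 1 (m≤n⇒m≤1+n p≤n)) (cong suc (+-∸-assoc 1 p≤n))) ⟨
  nth (x ∷ xs) (suc (suc n) ∸ p) ∎
  where
  open ≡-Reasoning
  n = List.length xs

nth-∈ : ∀ xs p → 1 ≤ p → p ≤ List.length xs → nth xs p ∈ xs
nth-∈ (x ∷ xs) (suc zero)    _ _       = here refl
nth-∈ (x ∷ xs) (suc (suc p)) _ (s≤s h) = there (nth-∈ xs (suc p) (s≤s z≤n) h)

nth-injective : ∀ xs → Unique xs → ∀ {p q} → 1 ≤ p → p ≤ List.length xs → 1 ≤ q → q ≤ List.length xs →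
                nth xs p ≡ nth xs q → p ≡ q
nth-injective (x ∷ xs) _ {suc zero} {suc zero} _ _ _ _ _ = refl
nth-injective (x ∷ xs) (x∉ ∷ _) {suc zero} {suc (suc q)} _ _ _ (s≤s h) e =
  ⊥-elim (All.lookup x∉ (nth-∈ xs (suc q) (s≤s z≤n) h) e)
nth-injective (x ∷ xs) (x∉ ∷ _) {suc (suc p)} {suc zero} _ (s≤s h) _ _ e =
  ⊥-elim (All.lookup x∉ (nth-∈ xs (suc p) (s≤s z≤n) h) (sym e))
nth-injective (x ∷ xs) (_ ∷ u) {suc (suc p)} {suc (suc q)} _ (s≤s hp) _ (s≤s hq) e =
  cong suc (nth-injective xs u (s≤s z≤n) hp (s≤s z≤n) hq e)

posL-nth : ∀ xs p → Unique xs → 1 ≤ p → p ≤ List.length xs → posL (nth xs p) xs ≡ p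
posL-nth (x ∷ xs) (suc zero)    _        _ _ rewrite ≡ᵇ-refl x = refl
posL-nth (x ∷ xs) (suc (suc p)) (x∉ ∷ u) _ (s≤s h)
  rewrite ≢⇒≡ᵇ-false (All.lookup x∉ (nth-∈ xs (suc p) (s≤s z≤n) h))
        | posL-nth xs (suc p) u (s≤s z≤n) h = refl

val-lookup : ∀ {n} (w : Vec ℕ n) (m : Fin n) → val w (suc (toℕ m)) ≡ lookup w m
val-lookup (x Vec.∷ w) Fin.zero    = refl
val-lookup (x Vec.∷ w) (Fin.suc m) = val-lookup w m

suc-toℕ-surjective : ∀ {n} p → 1 ≤ p → p ≤ n → Σ (Fin n) λ m → suc (toℕ m) ≡ p
suc-toℕ-surjective {suc n} (suc zero)    _ _       = Fin.zero , refl
suc-toℕ-surjective {suc n} (suc (suc p)) _ (s≤s h) with suc-toℕ-surjective {n} (suc p) (s≤s z≤n) h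
... | m , e = Fin.suc m , cong suc e

val-tabulate : ∀ {n} (g : Fin n → ℕ) (m : Fin n) → val (tabulate g) (suc (toℕ m)) ≡ g m
val-tabulate g m = trans (val-lookup (tabulate g) m) (Vec.lookup∘tabulate g m)

val-map : ∀ {n} (f : ℕ → ℕ) (w : Vec ℕ n) p → 1 ≤ p → p ≤ n → val (Vec.map f w) p ≡ f (val w p)
val-map f w p 1≤p p≤n with suc-toℕ-surjective p 1≤p p≤n
... | m , refl = begin
  val (Vec.map f w) (suc (toℕ m)) ≡⟨ val-lookup (Vec.map f w) m ⟩
  lookup (Vec.map f w) m          ≡⟨ Vec.lookup-map m f w ⟩
  f (lookup w m)                  ≡⟨ cong f (val-lookup w m) ⟨
  f (val w (suc (toℕ m)))         ∎
  where open ≡-Reasoning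

val-zipWith : ∀ {n} (f : ℕ → ℕ → ℕ) (v w : Vec ℕ n) p → 1 ≤ p → p ≤ n →
              val (Vec.zipWith f v w) p ≡ f (val v p) (val w p)
val-zipWith f v w p 1≤p p≤n with suc-toℕ-surjective p 1≤p p≤n
... | m , refl = begin
  val (Vec.zipWith f v w) (suc (toℕ m))       ≡⟨ val-lookup (Vec.zipWith f v w) m ⟩
  lookup (Vec.zipWith f v w) m                ≡⟨ Vec.lookup-zipWith f m v w ⟩
  f (lookup v m) (lookup w m)                 ≡⟨ cong₂ f (val-lookup v m) (val-lookup w m) ⟨
  f (val v (suc (toℕ m))) (val w (suc (toℕ m))) ∎
  where open ≡-Reasoning

val-replicate : ∀ {n} (x : ℕ) p → 1 ≤ p → p ≤ n → val (Vec.replicate n x) p ≡ x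
val-replicate {n} x p 1≤p p≤n with suc-toℕ-surjective p 1≤p p≤n
... | m , refl = trans (val-lookup (Vec.replicate n x) m) (Vec.lookup-replicate m x)

val-reverse : ∀ {n} (w : Vec ℕ n) p → 1 ≤ p → p ≤ n → val (Vec.reverse w) p ≡ val w (suc n ∸ p)
val-reverse {n} w p 1≤p p≤n = begin
  nth (toList (Vec.reverse w)) p                       ≡⟨ cong (λ xs → nth xs p) (Vec.toList-reverse w) ⟩
  nth (List.reverse (toList w)) p                      ≡⟨ nth-reverse (toList w) p 1≤p p≤len ⟩
  nth (toList w) (suc (List.length (toList w)) ∸ p)    ≡⟨ cong (λ l → nth (toList w) (suc l ∸ p)) (Vec.length-toList w) ⟩
  nth (toList w) (suc n ∸ p)                           ∎
  where
  open ≡-Reasoning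
  p≤len = subst (p ≤_) (sym (Vec.length-toList w)) p≤n

val-ext : ∀ {n} (v w : Vec ℕ n) → (∀ p → 1 ≤ p → p ≤ n → val v p ≡ val w p) → v ≡ w
val-ext Vec.[]      Vec.[]      _ = refl
val-ext (x Vec.∷ v) (y Vec.∷ w) h =
  cong₂ Vec._∷_ (h 1 (s≤s z≤n) (s≤s z≤n)) (val-ext v w λ { (suc p) _ p≤n → h (suc (suc p)) (s≤s z≤n) (s≤s p≤n) })

val-injective : ∀ {n} (w : Vec ℕ n) → Unique (toList w) → ∀ {p q} → 1 ≤ p → p ≤ n → 1 ≤ q → q ≤ n →
                val w p ≡ val w q → p ≡ q
val-injective w u 1≤p p≤n 1≤q q≤n =
  nth-injective (toList w) u 1≤p (subst (_ ≤_) (sym (Vec.length-toList w)) p≤n)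
                             1≤q (subst (_ ≤_) (sym (Vec.length-toList w)) q≤n)

inv-val : ∀ {n} (w : Vec ℕ n) → Unique (toList w) → ∀ {p a} → 1 ≤ p → p ≤ n → val w p ≡ a → inv w a ≡ p
inv-val w u {p} 1≤p p≤n refl = posL-nth (toList w) p u 1≤p (subst (p ≤_) (sym (Vec.length-toList w)) p≤n)

-- Position p of the reversed word w w₀ holds w(mirror N p).
mirror : ℕ → ℕ → ℕ
mirror N p = suc N ∸ p

mirror-involutive : ∀ N {p} → p ≤ suc N → mirror N (mirror N p) ≡ p
mirror-involutive N p≤ = m∸[m∸n]≡n p≤

mirror-bounded : ∀ N {p} → 1 ≤ p → p ≤ N → 1 ≤ mirror N p × mirror N p ≤ N
mirror-bounded N 1≤p p≤N = m<n⇒0<n∸m (s≤s p≤N) , ∸-monoʳ-≤ (suc N) 1≤p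

mirror-suc : ∀ N {p} → p ≤ N → mirror N p ≡ suc (N ∸ p)
mirror-suc N p≤N = +-∸-assoc 1 p≤N

≤∸-comm : ∀ {n i p} → p ≤ n → i ≤ n ∸ p → p ≤ n ∸ i
≤∸-comm {n} {i} {p} p≤n i≤n∸p = m+n≤o⇒m≤o∸n p (subst (_≤ n) (+-comm i p) (m≤o∸n⇒m+n≤o i p≤n i≤n∸p))

<∸-comm : ∀ {n j p} → p ≤ n → j ≤ n → n ∸ p < j → n ∸ j < p
<∸-comm p≤n j≤n n∸p<j = ≰⇒> λ p≤n∸j → <⇒≱ n∸p<j (≤∸-comm j≤n p≤n∸j)

-- Inversions of the reversed word

countBelow countAbove : ℕ → List ℕ → ℕ
countBelow x ys = List.length (List.filter (ℕ._<? x) ys)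
countAbove x ys = List.length (List.filter (x ℕ.<?_) ys)

countBelow-++ : ∀ x xs ys → countBelow x (xs ++ ys) ≡ countBelow x xs + countBelow x ys
countBelow-++ x xs ys = trans (cong List.length (List.filter-++ (ℕ._<? x) xs ys))
                              (List.length-++ (List.filter (ℕ._<? x) xs))

countAbove-∷ : ∀ x y ys → countAbove x (y ∷ ys) ≡ countBelow y (x ∷ []) + countAbove x ys
countAbove-∷ x y ys with x <ᵇ y
... | true  = refl
... | false = refl

countAbove-reverse : ∀ x ys → countAbove x (List.reverse ys) ≡ countAbove x ys
countAbove-reverse x ys = ↭-length (filter-↭ (x ℕ.<?_) (↭-reverse ys))

countAbove+countBelow : ∀ x ys → All (x ≢_) ys → countAbove x ys + countBelow x ys ≡ List.length ys
countAbove+countBelow x []       _           = refl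
countAbove+countBelow x (y ∷ ys) (x≢y ∷ x∉) with x <ᵇ y in x<y | y <ᵇ x in y<x
... | true  | true  = ⊥-elim (<-asym (<ᵇ⇒< x y (≡true⇒T x<y)) (<ᵇ⇒< y x (≡true⇒T y<x)))
... | true  | false = cong suc (countAbove+countBelow x ys x∉)
... | false | true  = trans (+-suc _ _) (cong suc (countAbove+countBelow x ys x∉))
... | false | false = ⊥-elim (x≢y (≤-antisym (≮⇒≥ λ y<x′ → subst T y<x (<⇒<ᵇ y<x′))
                                               (≮⇒≥ λ x<y′ → subst T x<y (<⇒<ᵇ x<y′))))

invsL-∷ʳ : ∀ ys x → invsL (ys ++ x ∷ []) ≡ invsL ys + countAbove x ys
invsL-∷ʳ []       x = refl
invsL-∷ʳ (y ∷ ys) x = begin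
  countBelow y (ys ++ x ∷ []) + invsL (ys ++ x ∷ [])
    ≡⟨ cong₂ _+_ (countBelow-++ y ys (x ∷ [])) (invsL-∷ʳ ys x) ⟩
  (countBelow y ys + countBelow y (x ∷ [])) + (invsL ys + countAbove x ys)
    ≡⟨ interchange (countBelow y ys) _ _ _ ⟩
  (countBelow y ys + invsL ys) + (countBelow y (x ∷ []) + countAbove x ys)
    ≡⟨ cong (countBelow y ys + invsL ys +_) (countAbove-∷ x y ys) ⟨
  (countBelow y ys + invsL ys) + countAbove x (y ∷ ys) ∎
  where open ≡-Reasoning

-- Every pair of distinct entries is an inversion of exactly one of xs and its reverse.
invsL-reverse : ∀ xs → Unique xs → invsL (List.reverse xs) + invsL xs ≡ List.length xs C 2
invsL-reverse []       _          = refl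
invsL-reverse (x ∷ xs) (x∉ ∷ uxs) = begin
  invsL (List.reverse (x ∷ xs)) + (countBelow x xs + invsL xs)
    ≡⟨ cong (λ l → invsL l + (countBelow x xs + invsL xs)) (List.unfold-reverse x xs) ⟩
  invsL (List.reverse xs ++ x ∷ []) + (countBelow x xs + invsL xs)
    ≡⟨ cong (_+ (countBelow x xs + invsL xs)) (invsL-∷ʳ (List.reverse xs) x) ⟩
  (invsL (List.reverse xs) + countAbove x (List.reverse xs)) + (countBelow x xs + invsL xs)
    ≡⟨ cong (λ c → (invsL (List.reverse xs) + c) + (countBelow x xs + invsL xs)) (countAbove-reverse x xs) ⟩
  (invsL (List.reverse xs) + countAbove x xs) + (countBelow x xs + invsL xs)
    ≡⟨ cong (_+ (countBelow x xs + invsL xs)) (+-comm (invsL (List.reverse xs)) _) ⟩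
  (countAbove x xs + invsL (List.reverse xs)) + (countBelow x xs + invsL xs)
    ≡⟨ interchange (countAbove x xs) _ _ _ ⟩
  (countAbove x xs + countBelow x xs) + (invsL (List.reverse xs) + invsL xs)
    ≡⟨ cong₂ _+_ (countAbove+countBelow x xs x∉) (invsL-reverse xs uxs) ⟩
  n + n C 2
    ≡⟨ cong (_+ n C 2) (nC1≡n n) ⟨
  n C 1 + n C 2
    ≡⟨ nCk+nC[k+1]≡[n+1]C[k+1] n 1 ⟩
  suc n C 2 ∎
  where
  open ≡-Reasoning
  n = List.length xs

len-reverse : ∀ {n} (w : Vec ℕ n) → Unique (toList w) → len (Vec.reverse w) + len w ≡ n C 2
len-reverse {n} w u = begin
  invsL (toList (Vec.reverse w)) + len w    ≡⟨ cong (λ l → invsL l + len w) (Vec.toList-reverse w) ⟩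
  invsL (List.reverse (toList w)) + len w   ≡⟨ invsL-reverse (toList w) u ⟩
  List.length (toList w) C 2                ≡⟨ cong (_C 2) (Vec.length-toList w) ⟩
  n C 2                                     ∎
  where open ≡-Reasoning

swapVal : ℕ → ℕ → ℕ → ℕ
swapVal a b x = if x ≡ᵇ a then b else (if x ≡ᵇ b then a else x)

swapVal-involutive : ∀ {a b} → a ≢ b → ∀ x → swapVal a b (swapVal a b x) ≡ x
swapVal-involutive {a} {b} a≢b x with x ≡ᵇ a in x≡a | x ≡ᵇ b in x≡b
... | true  | _     rewrite ≢⇒≡ᵇ-false (a≢b ∘ sym) | ≡ᵇ-refl b = sym (≡ᵇ⇒≡ x a (≡true⇒T x≡a))
... | false | true  rewrite ≡ᵇ-refl a = sym (≡ᵇ⇒≡ x b (≡true⇒T x≡b))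
... | false | false rewrite x≡a | x≡b = refl

swapVal-a : ∀ a b → swapVal a b a ≡ b
swapVal-a a b rewrite ≡ᵇ-refl a = refl

swapVal-b : ∀ {a b} → a ≢ b → swapVal a b b ≡ a
swapVal-b {a} {b} a≢b rewrite ≢⇒≡ᵇ-false (a≢b ∘ sym) | ≡ᵇ-refl b = refl

swapVal-fixes : ∀ {a b x} → x ≢ a → x ≢ b → swapVal a b x ≡ x
swapVal-fixes x≢a x≢b rewrite ≢⇒≡ᵇ-false x≢a | ≢⇒≡ᵇ-false x≢b = refl

swapVal-injective : ∀ {a b} → a ≢ b → ∀ {x y} → swapVal a b x ≡ swapVal a b y → x ≡ y
swapVal-injective a≢b {x} {y} e = begin
  x                                   ≡⟨ swapVal-involutive a≢b x ⟨
  swapVal _ _ (swapVal _ _ x)         ≡⟨ cong (swapVal _ _) e ⟩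
  swapVal _ _ (swapVal _ _ y)         ≡⟨ swapVal-involutive a≢b y ⟩
  y                                   ∎
  where open ≡-Reasoning

swapVal-preserves : ∀ (P : ℕ → Set) {a b x} → P a → P b → P x → P (swapVal a b x)
swapVal-preserves P {a} {b} {x} pa pb px with x ≡ᵇ a | x ≡ᵇ b
... | true  | _     = pb
... | false | true  = pa
... | false | false = px

swapVals-involutive : ∀ {n a b} → a ≢ b → (w : Vec ℕ n) → swapVals a b (swapVals a b w) ≡ w
swapVals-involutive {a = a} {b} a≢b w = begin
  Vec.map (swapVal a b) (Vec.map (swapVal a b) w) ≡⟨ Vec.map-∘ (swapVal a b) (swapVal a b) w ⟨
  Vec.map (swapVal a b ∘ swapVal a b) w          ≡⟨ Vec.map-cong (swapVal-involutive a≢b) w ⟩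
  Vec.map (λ x → x) w                             ≡⟨ Vec.map-id w ⟩
  w                                               ∎
  where open ≡-Reasoning

swapVals-reverse : ∀ {n} a b (w : Vec ℕ n) → swapVals a b (Vec.reverse w) ≡ Vec.reverse (swapVals a b w)
swapVals-reverse a b = Vec.map-reverse (swapVal a b)

Unique-swapVals : ∀ {n a b} → a ≢ b → (w : Vec ℕ n) → Unique (toList w) → Unique (toList (swapVals a b w))
Unique-swapVals {a = a} {b} a≢b w u rewrite Vec.toList-map (swapVal a b) w = Unique.map⁺ (swapVal-injective a≢b) u

IsPerm-swapVals : ∀ {N a b} → a ≢ b → (1 ≤ a × a ≤ N) → (1 ≤ b × b ≤ N) →
                  (w : Word N) → IsPerm N w → IsPerm N (swapVals a b w)
IsPerm-swapVals {N} {a} {b} a≢b a∈ b∈ w (w⊆ , uw) rewrite Vec.toList-map (swapVal a b) w =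
  All.map⁺ (All.map (swapVal-preserves (λ x → 1 ≤ x × x ≤ N) a∈ b∈) w⊆) , Unique.map⁺ (swapVal-injective a≢b) uw

Unique-reverse : ∀ {n} (w : Vec ℕ n) → Unique (toList w) → Unique (toList (Vec.reverse w))
Unique-reverse w u rewrite Vec.toList-reverse w = Unique-resp-↭ (↭⇒↭ₛ (↭-sym (↭-reverse (toList w)))) u

IsPerm-reverse : ∀ {N} (w : Word N) → IsPerm N w → IsPerm N (Vec.reverse w)
IsPerm-reverse w (w⊆ , uw) =
  subst (All _) (sym (Vec.toList-reverse w)) (All-resp-↭ (↭-sym (↭-reverse (toList w))) w⊆) , Unique-reverse w uw

swapAt : ℕ → ℕ → (ℕ → ℕ) → ℕ → ℕ
swapAt i j g p = if p ≡ᵇ i then g j else (if p ≡ᵇ j then g i else g p)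

val-swapPos : ∀ {n} i j (w : Vec ℕ n) p → 1 ≤ p → p ≤ n → val (swapPos i j w) p ≡ swapAt i j (val w) p
val-swapPos i j w p 1≤p p≤n with suc-toℕ-surjective p 1≤p p≤n
... | m , refl = trans (val-tabulate _ m) (cong (λ x → if suc (toℕ m) ≡ᵇ i then val w j else
                                                        (if suc (toℕ m) ≡ᵇ j then val w i else x))
                                                (sym (val-lookup w m)))

swapAt-cong : ∀ {i j g h} p → g i ≡ h i → g j ≡ h j → g p ≡ h p → swapAt i j g p ≡ swapAt i j h p
swapAt-cong {i} {j} p gi gj gp with p ≡ᵇ i | p ≡ᵇ j
... | true  | _     = gj
... | false | true  = gi
... | false | false = gp

swapAt-sym : ∀ i j g p → swapAt i j g p ≡ swapAt j i g p
swapAt-sym i j g p with p ≡ᵇ i in p≡i | p ≡ᵇ j in p≡j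
... | true  | true  = cong g (trans (sym (≡ᵇ⇒≡ p j (≡true⇒T p≡j))) (≡ᵇ⇒≡ p i (≡true⇒T p≡i)))
... | true  | false = refl
... | false | true  = refl
... | false | false = refl

swapAt-i : ∀ i j g → swapAt i j g i ≡ g j
swapAt-i i j g rewrite ≡ᵇ-refl i = refl

swapAt-j : ∀ i j g → swapAt i j g j ≡ g i
swapAt-j i j g = trans (swapAt-sym i j g j) (swapAt-i j i g)

swapAt-involutive : ∀ i j g p → swapAt i j (swapAt i j g) p ≡ g p
swapAt-involutive i j g p with p ≡ᵇ i in p≡i | p ≡ᵇ j in p≡j
... | true  | _     = trans (swapAt-j i j g) (cong g (sym (≡ᵇ⇒≡ p i (≡true⇒T p≡i))))
... | false | true  = trans (swapAt-i i j g) (cong g (sym (≡ᵇ⇒≡ p j (≡true⇒T p≡j))))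
... | false | false = refl

swapAt-conj : ∀ (σ : ℕ → ℕ) i j g p → σ (σ i) ≡ i → σ (σ j) ≡ j → σ (σ p) ≡ p →
              swapAt i j g (σ p) ≡ swapAt (σ i) (σ j) (g ∘ σ) p
swapAt-conj σ i j g p σσi σσj σσp with σ p ℕ.≟ i | σ p ℕ.≟ j
... | yes refl | _ = begin
  swapAt (σ p) j g (σ p)               ≡⟨ swapAt-i (σ p) j g ⟩
  g j                                  ≡⟨ cong g σσj ⟨
  g (σ (σ j))                          ≡⟨ swapAt-i p (σ j) (g ∘ σ) ⟨
  swapAt p (σ j) (g ∘ σ) p             ≡⟨ cong (λ x → swapAt x (σ j) (g ∘ σ) p) σσp ⟨
  swapAt (σ (σ p)) (σ j) (g ∘ σ) p     ∎
  where open ≡-Reasoning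
... | no _ | yes refl = begin
  swapAt i (σ p) g (σ p)               ≡⟨ swapAt-j i (σ p) g ⟩
  g i                                  ≡⟨ cong g σσi ⟨
  g (σ (σ i))                          ≡⟨ swapAt-j (σ i) p (g ∘ σ) ⟨
  swapAt (σ i) p (g ∘ σ) p             ≡⟨ cong (λ x → swapAt (σ i) x (g ∘ σ) p) σσp ⟨
  swapAt (σ i) (σ (σ p)) (g ∘ σ) p     ∎
  where open ≡-Reasoning
... | no σp≢i | no σp≢j rewrite ≢⇒≡ᵇ-false σp≢i | ≢⇒≡ᵇ-false σp≢j
                              | ≢⇒≡ᵇ-false (λ p≡σi → σp≢i (trans (cong σ p≡σi) σσi))
                              | ≢⇒≡ᵇ-false (λ p≡σj → σp≢j (trans (cong σ p≡σj) σσj)) = refl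

swapPos-involutive : ∀ {n i j} → 1 ≤ i → i ≤ n → 1 ≤ j → j ≤ n → (w : Vec ℕ n) → swapPos i j (swapPos i j w) ≡ w
swapPos-involutive {n} {i} {j} 1≤i i≤n 1≤j j≤n w = val-ext _ _ λ p 1≤p p≤n → begin
  val (swapPos i j (swapPos i j w)) p           ≡⟨ val-swapPos i j (swapPos i j w) p 1≤p p≤n ⟩
  swapAt i j (val (swapPos i j w)) p            ≡⟨ swapAt-cong p (val-swapPos i j w i 1≤i i≤n)
                                                                 (val-swapPos i j w j 1≤j j≤n)
                                                                 (val-swapPos i j w p 1≤p p≤n) ⟩
  swapAt i j (swapAt i j (val w)) p             ≡⟨ swapAt-involutive i j (val w) p ⟩
  val w p                                       ∎
  where open ≡-Reasoning

reverse-swapPos : ∀ {N i j} → 1 ≤ i → i ≤ N → 1 ≤ j → j ≤ N → (w : Vec ℕ N) →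
                  Vec.reverse (swapPos i j w) ≡ swapPos (mirror N j) (mirror N i) (Vec.reverse w)
reverse-swapPos {N} {i} {j} 1≤i i≤N 1≤j j≤N w = val-ext _ _ λ p 1≤p p≤N →
  let (1≤p′ , p′≤N) = mirror-bounded N 1≤p p≤N in begin
  val (Vec.reverse (swapPos i j w)) p
    ≡⟨ val-reverse (swapPos i j w) p 1≤p p≤N ⟩
  val (swapPos i j w) (mirror N p)
    ≡⟨ val-swapPos i j w (mirror N p) 1≤p′ p′≤N ⟩
  swapAt i j (val w) (mirror N p)
    ≡⟨ swapAt-conj (mirror N) i j (val w) p (mirror-involutive N (m≤n⇒m≤1+n i≤N))
                   (mirror-involutive N (m≤n⇒m≤1+n j≤N)) (mirror-involutive N (m≤n⇒m≤1+n p≤N)) ⟩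
  swapAt (mirror N i) (mirror N j) (val w ∘ mirror N) p
    ≡⟨ swapAt-sym (mirror N i) (mirror N j) (val w ∘ mirror N) p ⟩
  swapAt (mirror N j) (mirror N i) (val w ∘ mirror N) p
    ≡⟨ swapAt-cong {g = val (Vec.reverse w)} {h = val w ∘ mirror N} p
                   (reversed j 1≤j j≤N) (reversed i 1≤i i≤N) (val-reverse w p 1≤p p≤N) ⟨
  swapAt (mirror N j) (mirror N i) (val (Vec.reverse w)) p
    ≡⟨ val-swapPos (mirror N j) (mirror N i) (Vec.reverse w) p 1≤p p≤N ⟨
  val (swapPos (mirror N j) (mirror N i) (Vec.reverse w)) p ∎
  where
  open ≡-Reasoning
  reversed : ∀ q → 1 ≤ q → q ≤ N → val (Vec.reverse w) (mirror N q) ≡ val w (mirror N (mirror N q))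
  reversed q 1≤q q≤N = let (1≤q′ , q′≤N) = mirror-bounded N 1≤q q≤N in val-reverse w (mirror N q) 1≤q′ q′≤N

_⊕_ : ∀ {n} → Vec ℕ n → Vec ℕ n → Vec ℕ n
_⊕_ = Vec.zipWith _+_

reverse-replicate : ∀ n (x : ℕ) → Vec.reverse (Vec.replicate n x) ≡ Vec.replicate n x
reverse-replicate n x = val-ext _ _ λ p 1≤p p≤n → let (1≤p′ , p′≤n) = mirror-bounded n 1≤p p≤n in
  trans (val-reverse (Vec.replicate n x) p 1≤p p≤n)
        (trans (val-replicate x (mirror n p) 1≤p′ p′≤n) (sym (val-replicate x p 1≤p p≤n)))

reverse-zeroE : ∀ N → Vec.reverse (zeroE N) ≡ zeroE N
reverse-zeroE N = reverse-replicate (N ∸ 1) 0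

reverse-zipWith : ∀ {n} (f : ℕ → ℕ → ℕ) (u v : Vec ℕ n) →
                  Vec.reverse (Vec.zipWith f u v) ≡ Vec.zipWith f (Vec.reverse u) (Vec.reverse v)
reverse-zipWith {n} f u v = val-ext _ _ λ p 1≤p p≤n → let (1≤p′ , p′≤n) = mirror-bounded n 1≤p p≤n in begin
  val (Vec.reverse (Vec.zipWith f u v)) p              ≡⟨ val-reverse (Vec.zipWith f u v) p 1≤p p≤n ⟩
  val (Vec.zipWith f u v) (mirror n p)                 ≡⟨ val-zipWith f u v (mirror n p) 1≤p′ p′≤n ⟩
  f (val u (mirror n p)) (val v (mirror n p))          ≡⟨ cong₂ f (val-reverse u p 1≤p p≤n) (val-reverse v p 1≤p p≤n) ⟨
  f (val (Vec.reverse u) p) (val (Vec.reverse v) p)    ≡⟨ val-zipWith f (Vec.reverse u) (Vec.reverse v) p 1≤p p≤n ⟨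
  val (Vec.zipWith f (Vec.reverse u) (Vec.reverse v)) p ∎
  where open ≡-Reasoning

deg-reverse : ∀ N (β : Exps N) → deg N (Vec.reverse β) ≡ deg N β
deg-reverse N β = trans (cong sum (Vec.toList-reverse β)) (sum-↭ (↭-reverse (toList β)))

deg-zeroE : ∀ N → deg N (zeroE N) ≡ 0
deg-zeroE N = go (N ∸ 1)
  where
  go : ∀ n → sum (toList (Vec.replicate n 0)) ≡ 0
  go zero    = refl
  go (suc n) = go n

val-qE : ∀ N i j p → 1 ≤ p → p ≤ N ∸ 1 → val (qE N i j) p ≡ (if (i ≤ᵇ p) ∧ (p <ᵇ j) then 1 else 0)
val-qE N i j p 1≤p p≤ with suc-toℕ-surjective p 1≤p p≤
... | m , refl = val-tabulate _ m

qE-reverse : ∀ N {i j} → i ≤ N → j ≤ N → Vec.reverse (qE N i j) ≡ qE N (mirror N j) (mirror N i)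
qE-reverse zero          _   _   = refl
qE-reverse N@(suc M) {i} {j} i≤N j≤N = val-ext _ _ λ p 1≤p p≤M → begin
  val (Vec.reverse (qE N i j)) p
    ≡⟨ val-reverse (qE N i j) p 1≤p p≤M ⟩
  val (qE N i j) (N ∸ p)
    ≡⟨ val-qE N i j (N ∸ p) (m<n⇒0<n∸m (s≤s p≤M)) (∸-monoʳ-≤ N 1≤p) ⟩
  (if (i ≤ᵇ N ∸ p) ∧ (N ∸ p <ᵇ j) then 1 else 0)
    ≡⟨ cong (λ c → if c then 1 else 0)
            (trans (cong₂ _∧_ (lower p≤M) (upper p≤M)) (∧-comm (p <ᵇ mirror N i) (mirror N j ≤ᵇ p))) ⟩
  (if (mirror N j ≤ᵇ p) ∧ (p <ᵇ mirror N i) then 1 else 0)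
    ≡⟨ val-qE N (mirror N j) (mirror N i) p 1≤p p≤M ⟨
  val (qE N (mirror N j) (mirror N i)) p ∎
  where
  open ≡-Reasoning
  lower : ∀ {p} → p ≤ M → (i ≤ᵇ N ∸ p) ≡ (p <ᵇ mirror N i)
  lower {p} p≤M = T⇔T⇒≡
    (λ t → <⇒<ᵇ (subst (p <_) (sym (mirror-suc N i≤N)) (s≤s (≤∸-comm (m≤n⇒m≤1+n p≤M) (≤ᵇ⇒≤ i (N ∸ p) t)))))
    (λ t → ≤⇒≤ᵇ (≤∸-comm i≤N (≤-pred (subst (p <_) (mirror-suc N i≤N) (<ᵇ⇒< p (mirror N i) t)))))
  upper : ∀ {p} → p ≤ M → (N ∸ p <ᵇ j) ≡ (mirror N j ≤ᵇ p)
  upper {p} p≤M = T⇔T⇒≡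
    (λ t → ≤⇒≤ᵇ (subst (_≤ p) (sym (mirror-suc N j≤N)) (<∸-comm (m≤n⇒m≤1+n p≤M) j≤N (<ᵇ⇒< (N ∸ p) j t))))
    (λ t → <⇒<ᵇ (<∸-comm j≤N (m≤n⇒m≤1+n p≤M) (subst (_≤ p) (mirror-suc N j≤N) (≤ᵇ⇒≤ (mirror N j) p t))))

qlen-zeroE : ∀ N (w : Word N) → qlen N (zeroE N , w) ≡ len w
qlen-zeroE N w rewrite deg-zeroE N = +-identityʳ (len w)

-- Covers in the quantum k-Bruhat order

∈-range⁻ : ∀ s t {m} → m ∈ range s t → s < m × m ≤ t
∈-range⁻ s t m∈ with x , x∈ , refl ← ∈.∈-map⁻ (λ x → suc (s + x)) m∈ =
  s≤s (m≤m+n s x) , subst (_≤ t) (cong suc (+-comm x s)) (m≤o∸n⇒m+n≤o (suc x) s≤t x<t∸s)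
  where
  x<t∸s = ∈.∈-upTo⁻ x∈
  s≤t = <⇒≤ (m∸n≢0⇒n<m λ t∸s≡0 → n≮0 (subst (x <_) t∸s≡0 x<t∸s))

∈-range⁺ : ∀ s t {m} → s < m → m ≤ t → m ∈ range s t
∈-range⁺ s t {suc m} (s≤s s≤m) m<t =
  subst (_∈ range s t) (cong suc (m+[n∸m]≡n s≤m)) (∈.∈-map⁺ (λ x → suc (s + x)) (∈.∈-upTo⁺ (∸-monoˡ-< m<t s≤m)))

record Cover (N k : ℕ) (u : Word N) (β : Exps N) (w : Word N) : Set where
  constructor cover
  field
    {i j}   : ℕ
    0<i     : 0 < i
    i≤k     : i ≤ k
    k<j     : k < j
    j≤N     : j ≤ N
    w≡usᵢⱼ  : w ≡ swapPos i j u
    shape   : β ≡ zeroE N ⊎ β ≡ qE N i j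
    graded  : qlen N (β , w) ≡ suc (len u)

module _ (N k : ℕ) (u : Word N) (β : Exps N) (w : Word N) where

  private
    graded? : ℕ → ℕ → Bool
    graded? i j = ((β =ᵉ zeroE N) ∧ (len w ≡ᵇ suc (len u))) ∨ ((β =ᵉ qE N i j) ∧ (qlen N (β , w) ≡ᵇ suc (len u)))

    covers-via : ℕ → ℕ → Bool
    covers-via i j = (w =ᵉ swapPos i j u) ∧ graded? i j

    covers-from : ℕ → Bool
    covers-from i = any (covers-via i) (range k N)

  covers⇒Cover : T (covers N k u (β , w)) → Cover N k u β w
  covers⇒Cover cov
    with i , i∈ , cov′ ← find (any⁻ covers-from (range 0 k) cov)
    with j , j∈ , cov″ ← find (any⁻ (covers-via i) (range k N) cov′)
    with w≡ , grade ← Equivalence.to T-∧ cov″ =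
    let (0<i , i≤k) = ∈-range⁻ 0 k i∈ ; (k<j , j≤N) = ∈-range⁻ k N j∈ in
    cover 0<i i≤k k<j j≤N (toWitness w≡) (proj₁ (shapeAndGrade grade)) (proj₂ (shapeAndGrade grade))
    where
    shapeAndGrade : T (graded? i j) → (β ≡ zeroE N ⊎ β ≡ qE N i j) × qlen N (β , w) ≡ suc (len u)
    shapeAndGrade grade with Equivalence.to (T-∨ {(β =ᵉ zeroE N) ∧ (len w ≡ᵇ suc (len u))}) grade
    ... | inj₁ classical with β≡0 , ℓ ← Equivalence.to (T-∧ {β =ᵉ zeroE N}) classical =
      let β≡0 = toWitness β≡0 in
      inj₁ β≡0 , trans (cong (λ γ → qlen N (γ , w)) β≡0) (trans (qlen-zeroE N w) (≡ᵇ⇒≡ _ _ ℓ))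
    ... | inj₂ quantum with β≡q , ℓ ← Equivalence.to (T-∧ {β =ᵉ qE N i j}) quantum = inj₂ (toWitness β≡q) , ≡ᵇ⇒≡ _ _ ℓ

  Cover⇒covers : Cover N k u β w → T (covers N k u (β , w))
  Cover⇒covers (cover {i} {j} 0<i i≤k k<j j≤N w≡ shape graded) =
    any⁺ covers-from (lose (∈-range⁺ 0 k 0<i i≤k)
      (any⁺ (covers-via i) (lose (∈-range⁺ k N k<j j≤N)
        (Equivalence.from (T-∧ {w =ᵉ swapPos i j u}) (fromWitness w≡ , grade shape)))))
    where
    grade : β ≡ zeroE N ⊎ β ≡ qE N i j → T (graded? i j)
    grade (inj₁ refl) = Equivalence.from (T-∨ {(β =ᵉ zeroE N) ∧ (len w ≡ᵇ suc (len u))})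
      (inj₁ (Equivalence.from (T-∧ {β =ᵉ zeroE N}) (fromWitness refl , ≡⇒≡ᵇ _ _ (trans (sym (qlen-zeroE N w)) graded))))
    grade (inj₂ refl) = Equivalence.from (T-∨ {(β =ᵉ zeroE N) ∧ (len w ≡ᵇ suc (len u))})
      (inj₂ (Equivalence.from (T-∧ {β =ᵉ qE N i j}) (fromWitness refl , ≡⇒≡ᵇ _ _ graded)))

complement-step : ∀ {C ru lu rw lw d : ℕ} → ru + lu ≡ C → rw + lw ≡ C → lw + d ≡ suc lu → ru + d ≡ suc rw
complement-step {C} {ru} {lu} {rw} {lw} {d} ru+lu rw+lw lw+d = +-cancelʳ-≡ lw (ru + d) (suc rw) (begin
  ru + d + lw     ≡⟨ +-assoc ru d lw ⟩
  ru + (d + lw)   ≡⟨ cong (ru +_) (trans (+-comm d lw) lw+d) ⟩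
  ru + suc lu     ≡⟨ +-suc ru lu ⟩
  suc (ru + lu)   ≡⟨ cong suc (trans ru+lu (sym rw+lw)) ⟩
  suc (rw + lw)   ∎)
  where open ≡-Reasoning

Cover-reverse : ∀ {N k u β w} → Unique (toList u) → Unique (toList w) → Cover N k u β w →
                Cover N (N ∸ k) (Vec.reverse w) (Vec.reverse β) (Vec.reverse u)
Cover-reverse {N} {k} {u} {β} {w} uu uw (cover {i} {j} 0<i i≤k k<j j≤N w≡ shape graded) =
  cover (proj₁ (mirror-bounded N 1≤j j≤N)) (∸-monoʳ-≤ (suc N) k<j)
        (subst (_≤ mirror N i) (mirror-suc N k≤N) (∸-monoʳ-≤ (suc N) i≤k)) (proj₂ (mirror-bounded N 0<i i≤N))
        u′≡ (shape′ shape) graded′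
  where
  open ≡-Reasoning
  k≤N = <⇒≤ (<-≤-trans k<j j≤N)
  i≤N = ≤-trans i≤k k≤N
  1≤j = <-≤-trans (s≤s z≤n) k<j
  u′≡ : Vec.reverse u ≡ swapPos (mirror N j) (mirror N i) (Vec.reverse w)
  u′≡ = begin
    Vec.reverse u                        ≡⟨ cong Vec.reverse (swapPos-involutive 0<i i≤N 1≤j j≤N u) ⟨
    Vec.reverse (swapPos i j (swapPos i j u))
                                         ≡⟨ cong (λ v → Vec.reverse (swapPos i j v)) w≡ ⟨
    Vec.reverse (swapPos i j w)          ≡⟨ reverse-swapPos 0<i i≤N 1≤j j≤N w ⟩
    swapPos (mirror N j) (mirror N i) (Vec.reverse w) ∎
  shape′ : β ≡ zeroE N ⊎ β ≡ qE N i j → Vec.reverse β ≡ zeroE N ⊎ Vec.reverse β ≡ qE N (mirror N j) (mirror N i)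
  shape′ (inj₁ refl) = inj₁ (reverse-zeroE N)
  shape′ (inj₂ refl) = inj₂ (qE-reverse N i≤N j≤N)
  graded′ : qlen N (Vec.reverse β , Vec.reverse u) ≡ suc (len (Vec.reverse w))
  graded′ rewrite deg-reverse N β = complement-step (len-reverse u uu) (len-reverse w uw) graded

-- The action of a single operator

shift : ∀ {N} → Exps N → QPerm N → QPerm N
shift α (β , y) = α ⊕ β , y

step-shift : ∀ N k o α u → step N k o (α , u) ≡ Maybe.map (shift α) (step N k o (zeroE N , u))
step-shift N k o α u with a o <ᵇ b o
... | true with covers N k u (zeroE N , swapVals (a o) (b o) u)
...   | true  = cong (λ γ → just (γ , swapVals (a o) (b o) u)) (sym (Vec.zipWith-identityʳ +-identityʳ α))
...   | false = refl
step-shift N k o α u | false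
  with (inv u (a o) <ᵇ inv u (b o)) ∧ covers N k u (qE N (inv u (a o)) (inv u (b o)) , swapVals (a o) (b o) u)
...   | true  = cong (λ γ → just (α ⊕ γ , swapVals (a o) (b o) u)) (sym (Vec.zipWith-identityˡ +-identityˡ _))
...   | false = refl

act-shift : ∀ N k v α u → act N k v (α , u) ≡ Maybe.map (shift α) (act N k v (zeroE N , u))
act-shift N k []      α u = cong (λ γ → just (γ , u)) (sym (Vec.zipWith-identityʳ +-identityʳ α))
act-shift N k (o ∷ v) α u rewrite act-shift N k v α u with act N k v (zeroE N , u)
... | nothing      = refl
... | just (β , y) rewrite step-shift N k o (α ⊕ β) y | step-shift N k o β y with step N k o (zeroE N , y)
...   | nothing      = refl
...   | just (γ , z) = cong (λ δ → just (δ , z)) (Vec.zipWith-assoc +-assoc α β γ)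

step-swapVals : ∀ N k o α u {β y} → step N k o (α , u) ≡ just (β , y) → y ≡ swapVals (a o) (b o) u
step-swapVals N k o α u eq with a o <ᵇ b o
... | true with covers N k u (zeroE N , swapVals (a o) (b o) u)
...   | true with refl ← eq = refl
step-swapVals N k o α u eq | false
  with (inv u (a o) <ᵇ inv u (b o)) ∧ covers N k u (qE N (inv u (a o)) (inv u (b o)) , swapVals (a o) (b o) u)
...   | true with refl ← eq = refl

-- If s_ab u = u s_ij with i < j, then {u(i), u(j)} = {a, b}; the order is forced by u⁻¹(a) < u⁻¹(b).
transposed-positions : ∀ {N a b i j} (u : Word N) → a ≢ b → Unique (toList u) → swapVals a b u ≡ swapPos i j u →
                       1 ≤ i → i < j → j ≤ N → inv u a < inv u b → val u i ≡ a × val u j ≡ b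
transposed-positions {N} {a} {b} {i} {j} u a≢b uu su≡us 1≤i i<j j≤N ua<ub = classify (val u i ≟ a) (val u i ≟ b)
  where
  i≤N = ≤-trans (<⇒≤ i<j) j≤N
  1≤j = ≤-trans 1≤i (<⇒≤ i<j)
  image-of-i : swapVal a b (val u i) ≡ val u j
  image-of-i = begin
    swapVal a b (val u i)       ≡⟨ val-map (swapVal a b) u i 1≤i i≤N ⟨
    val (swapVals a b u) i      ≡⟨ cong (λ v → val v i) su≡us ⟩
    val (swapPos i j u) i       ≡⟨ val-swapPos i j u i 1≤i i≤N ⟩
    swapAt i j (val u) i        ≡⟨ swapAt-i i j (val u) ⟩
    val u j                     ∎
    where open ≡-Reasoning
  classify : Dec (val u i ≡ a) → Dec (val u i ≡ b) → val u i ≡ a × val u j ≡ b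
  classify (yes ui≡a) _ = ui≡a , trans (sym image-of-i) (trans (cong (swapVal a b) ui≡a) (swapVal-a a b))
  classify (no _) (yes ui≡b) = contradiction (subst₂ _<_ (inv-val u uu 1≤j j≤N uj≡a) (inv-val u uu 1≤i i≤N ui≡b) ua<ub)
                                             (<⇒≯ i<j)
    where uj≡a = trans (sym image-of-i) (trans (cong (swapVal a b) ui≡b) (swapVal-b a≢b))
  classify (no ui≢a) (no ui≢b) =
    contradiction (val-injective u uu 1≤i i≤N 1≤j j≤N (trans (sym (swapVal-fixes ui≢a ui≢b)) image-of-i)) (<⇒≢ i<j)

reverse-swapVals-cancel : ∀ {n a b} → a ≢ b → (u : Vec ℕ n) →
                          swapVals a b (Vec.reverse (swapVals a b u)) ≡ Vec.reverse u
reverse-swapVals-cancel {a = a} {b} a≢b u =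
  trans (swapVals-reverse a b (swapVals a b u)) (cong Vec.reverse (swapVals-involutive a≢b u))

reverse-covers : ∀ {N k u β w} → Unique (toList u) → Unique (toList w) → T (covers N k u (β , w)) →
                 T (covers N (N ∸ k) (Vec.reverse w) (Vec.reverse β , Vec.reverse u))
reverse-covers {N} {k} {u} {β} {w} uu uw cov =
  Cover⇒covers N (N ∸ k) _ _ _ (Cover-reverse uu uw (covers⇒Cover N k u β w cov))

-- In a quantum step, a and b sit in y w₀ at the mirrors of their positions in u, so q_{u⁻¹(a) u⁻¹(b)} is reversed too.
quantum-step-reverse : ∀ {N k a b} (u : Word N) → a ≢ b → Unique (toList u) →
  inv u a < inv u b → T (covers N k u (qE N (inv u a) (inv u b) , swapVals a b u)) →
  let y′ = Vec.reverse (swapVals a b u) in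
  ((inv y′ a <ᵇ inv y′ b) ∧ covers N (N ∸ k) y′ (qE N (inv y′ a) (inv y′ b) , swapVals a b y′)) ≡ true
  × qE N (inv y′ a) (inv y′ b) ≡ Vec.reverse (qE N (inv u a) (inv u b))
quantum-step-reverse {N} {k} {a} {b} u a≢b uu ua<ub cov =
  T⇒≡true (Equivalence.from T-∧ (<⇒<ᵇ (subst₂ _<_ (sym y′a≡) (sym y′b≡) (∸-monoʳ-< i<j (m≤n⇒m≤1+n j≤N))) , cov′)) , qE≡
  where
  open ≡-Reasoning
  open Cover (covers⇒Cover N k u (qE N (inv u a) (inv u b)) (swapVals a b u) cov) renaming (w≡usᵢⱼ to su≡us)
  y′ = Vec.reverse (swapVals a b u)
  usu = Unique-swapVals a≢b u uu
  i<j = ≤-<-trans i≤k k<j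
  i≤N = ≤-trans (<⇒≤ i<j) j≤N
  1≤j = ≤-trans 0<i (<⇒≤ i<j)
  positions = transposed-positions u a≢b uu su≡us 0<i i<j j≤N ua<ub
  ua≡i : inv u a ≡ i
  ua≡i = inv-val u uu 0<i i≤N (proj₁ positions)
  ub≡j : inv u b ≡ j
  ub≡j = inv-val u uu 1≤j j≤N (proj₂ positions)
  y′-at-mirror : ∀ {p c d} → 1 ≤ p → p ≤ N → val u p ≡ c → swapVal a b c ≡ d → inv y′ d ≡ mirror N p
  y′-at-mirror {p} {c} {d} 1≤p p≤N up≡c sc≡d = let (1≤p′ , p′≤N) = mirror-bounded N 1≤p p≤N in
    inv-val y′ (Unique-reverse _ usu) 1≤p′ p′≤N (begin
      val y′ (mirror N p)                         ≡⟨ val-reverse (swapVals a b u) (mirror N p) 1≤p′ p′≤N ⟩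
      val (swapVals a b u) (mirror N (mirror N p)) ≡⟨ cong (val (swapVals a b u)) (mirror-involutive N (m≤n⇒m≤1+n p≤N)) ⟩
      val (swapVals a b u) p                      ≡⟨ val-map (swapVal a b) u p 1≤p p≤N ⟩
      swapVal a b (val u p)                       ≡⟨ cong (swapVal a b) up≡c ⟩
      swapVal a b c                               ≡⟨ sc≡d ⟩
      d                                           ∎)
  y′a≡ : inv y′ a ≡ mirror N j
  y′a≡ = y′-at-mirror 1≤j j≤N (proj₂ positions) (swapVal-b a≢b)
  y′b≡ : inv y′ b ≡ mirror N i
  y′b≡ = y′-at-mirror 0<i i≤N (proj₁ positions) (swapVal-a a b)
  qE≡ : qE N (inv y′ a) (inv y′ b) ≡ Vec.reverse (qE N (inv u a) (inv u b))
  qE≡ = begin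
    qE N (inv y′ a) (inv y′ b)              ≡⟨ cong₂ (qE N) y′a≡ y′b≡ ⟩
    qE N (mirror N j) (mirror N i)          ≡⟨ qE-reverse N i≤N j≤N ⟨
    Vec.reverse (qE N i j)                  ≡⟨ cong₂ (λ p q → Vec.reverse (qE N p q)) ua≡i ub≡j ⟨
    Vec.reverse (qE N (inv u a) (inv u b))  ∎
  cov′ : T (covers N (N ∸ k) y′ (qE N (inv y′ a) (inv y′ b) , swapVals a b y′))
  cov′ = subst₂ (λ β y → T (covers N (N ∸ k) y′ (β , y))) (sym qE≡) (sym (reverse-swapVals-cancel a≢b u))
                (reverse-covers {N} {k} {β = qE N (inv u a) (inv u b)} uu usu cov)

ClassicalStep QuantumStep : ∀ N k → Op → Exps N → Word N → Exps N → Word N → Set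
ClassicalStep N k o α u β y =
  (a o <ᵇ b o) ≡ true × T (covers N k u (zeroE N , swapVals (a o) (b o) u)) × β ≡ α × y ≡ swapVals (a o) (b o) u
QuantumStep N k o α u β y =
  (a o <ᵇ b o) ≡ false × T (inv u (a o) <ᵇ inv u (b o)) ×
  T (covers N k u (qE N (inv u (a o)) (inv u (b o)) , swapVals (a o) (b o) u)) ×
  β ≡ α ⊕ qE N (inv u (a o)) (inv u (b o)) × y ≡ swapVals (a o) (b o) u

step-inversion : ∀ N k o α u {β y} → step N k o (α , u) ≡ just (β , y) →
                 ClassicalStep N k o α u β y ⊎ QuantumStep N k o α u β y
step-inversion N k o α u eq with a o <ᵇ b o
... | true with covers N k u (zeroE N , swapVals (a o) (b o) u)
...   | true with refl ← eq = inj₁ (refl , _ , refl , refl)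
step-inversion N k o α u eq | false
  with (inv u (a o) <ᵇ inv u (b o)) ∧ covers N k u (qE N (inv u (a o)) (inv u (b o)) , swapVals (a o) (b o) u) in cov
...   | true with refl ← eq with ua<ub , cov′ ← Equivalence.to (T-∧ {inv u (a o) <ᵇ inv u (b o)}) (≡true⇒T cov) =
  inj₂ (refl , ua<ub , cov′ , refl , refl)

step-classical : ∀ N k o α u → (a o <ᵇ b o) ≡ true → T (covers N k u (zeroE N , swapVals (a o) (b o) u)) →
                 step N k o (α , u) ≡ just (α , swapVals (a o) (b o) u)
step-classical N k o α u a<b cov rewrite a<b | T⇒≡true cov = refl

step-quantum : ∀ N k o α u → (a o <ᵇ b o) ≡ false →
               ((inv u (a o) <ᵇ inv u (b o)) ∧
                covers N k u (qE N (inv u (a o)) (inv u (b o)) , swapVals (a o) (b o) u)) ≡ true →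
               step N k o (α , u) ≡ just (α ⊕ qE N (inv u (a o)) (inv u (b o)) , swapVals (a o) (b o) u)
step-quantum N k o α u a≮b cond rewrite a≮b | cond = refl

step-reverse : ∀ N k o {u Δ y} → Unique (toList u) → step N k o (zeroE N , u) ≡ just (Δ , y) →
               step N (N ∸ k) o (zeroE N , Vec.reverse y) ≡ just (Vec.reverse Δ , Vec.reverse u)
step-reverse N k o {u} uu eq with step-inversion N k o (zeroE N) u eq
... | inj₁ (a<b , cov , refl , refl) = begin
  step N (N ∸ k) o (zeroE N , y′)        ≡⟨ step-classical N (N ∸ k) o (zeroE N) y′ a<b cov′ ⟩
  just (zeroE N , swapVals A B y′)       ≡⟨ cong₂ (λ β y → just (β , y)) (sym (reverse-zeroE N))
                                                   (reverse-swapVals-cancel (a≢b o) u) ⟩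
  just (Vec.reverse (zeroE N) , Vec.reverse u) ∎
  where
  open ≡-Reasoning
  A = a o
  B = b o
  y′ = Vec.reverse (swapVals A B u)
  reversed : T (covers N (N ∸ k) y′ (Vec.reverse (zeroE N) , Vec.reverse u))
  reversed = reverse-covers {N} {k} {u} {zeroE N} {swapVals A B u} uu (Unique-swapVals (a≢b o) u uu) cov
  cov′ : T (covers N (N ∸ k) y′ (zeroE N , swapVals A B y′))
  cov′ = subst₂ (λ β y → T (covers N (N ∸ k) y′ (β , y))) (reverse-zeroE N)
                (sym (reverse-swapVals-cancel (a≢b o) u)) reversed
... | inj₂ (a≮b , ua<ub , cov , refl , refl) = begin
  step N (N ∸ k) o (zeroE N , y′)
    ≡⟨ step-quantum N (N ∸ k) o (zeroE N) y′ a≮b (proj₁ reversed) ⟩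
  just (zeroE N ⊕ qE N (inv y′ A) (inv y′ B) , swapVals A B y′)
    ≡⟨ cong₂ (λ β y → just (β , y)) exponent (reverse-swapVals-cancel (a≢b o) u) ⟩
  just (Vec.reverse (zeroE N ⊕ qE N (inv u A) (inv u B)) , Vec.reverse u) ∎
  where
  open ≡-Reasoning
  A = a o
  B = b o
  y′ = Vec.reverse (swapVals A B u)
  reversed = quantum-step-reverse {N} {k} {A} {B} u (a≢b o) uu (<ᵇ⇒< (inv u A) (inv u B) ua<ub) cov
  ⊕-identityˡ : ∀ {n} (β : Vec ℕ n) → Vec.replicate n 0 ⊕ β ≡ β
  ⊕-identityˡ = Vec.zipWith-identityˡ +-identityˡ
  exponent : zeroE N ⊕ qE N (inv y′ A) (inv y′ B) ≡ Vec.reverse (zeroE N ⊕ qE N (inv u A) (inv u B))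
  exponent = begin
    zeroE N ⊕ qE N (inv y′ A) (inv y′ B)               ≡⟨ ⊕-identityˡ (qE N (inv y′ A) (inv y′ B)) ⟩
    qE N (inv y′ A) (inv y′ B)                         ≡⟨ proj₂ reversed ⟩
    Vec.reverse (qE N (inv u A) (inv u B))             ≡⟨ cong Vec.reverse (⊕-identityˡ (qE N (inv u A) (inv u B))) ⟨
    Vec.reverse (zeroE N ⊕ qE N (inv u A) (inv u B))   ∎

-- Compositions

act-++ : ∀ N k xs ys (x : QPerm N) → act N k (xs ++ ys) x ≡ (act N k ys x >>= act N k xs)
act-++ N k []       ys x with act N k ys x
... | nothing = refl
... | just z  = refl
act-++ N k (o ∷ xs) ys x rewrite act-++ N k xs ys x with act N k ys x
... | nothing = refl
... | just z  = refl

act-reverse : ∀ N k v {u Δ y} → IsPerm N u → SuppIn N v → act N k v (zeroE N , u) ≡ just (Δ , y) →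
              IsPerm N y × act N (N ∸ k) (ρ v) (zeroE N , Vec.reverse y) ≡ just (Vec.reverse Δ , Vec.reverse u)
act-reverse N k []      {u} pu _ refl = pu , cong (λ β → just (β , Vec.reverse u)) (sym (reverse-zeroE N))
act-reverse N k (o ∷ v) {u} pu (o∈ ∷ v⊆) eq with act N k v (zeroE N , u) in e₁
... | just (Δ₁ , y₁) with step N k o (zeroE N , y₁) in e₂ | step-shift N k o Δ₁ y₁
...   | nothing       | shifted with () ← trans (sym shifted) eq
...   | just (Δ₂ , y) | shifted with refl ← trans (sym shifted) eq = py , (begin
  act N (N ∸ k) (ρ (o ∷ v)) (zeroE N , Vec.reverse y)
    ≡⟨ cong (λ w → act N (N ∸ k) w (zeroE N , Vec.reverse y)) (List.unfold-reverse o v) ⟩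
  act N (N ∸ k) (ρ v ++ o ∷ []) (zeroE N , Vec.reverse y)
    ≡⟨ act-++ N (N ∸ k) (ρ v) (o ∷ []) (zeroE N , Vec.reverse y) ⟩
  (step N (N ∸ k) o (zeroE N , Vec.reverse y) >>= act N (N ∸ k) (ρ v))
    ≡⟨ cong (_>>= act N (N ∸ k) (ρ v)) (step-reverse N k o (proj₂ py₁) e₂) ⟩
  act N (N ∸ k) (ρ v) (Vec.reverse Δ₂ , Vec.reverse y₁)
    ≡⟨ act-shift N (N ∸ k) (ρ v) (Vec.reverse Δ₂) (Vec.reverse y₁) ⟩
  Maybe.map (shift (Vec.reverse Δ₂)) (act N (N ∸ k) (ρ v) (zeroE N , Vec.reverse y₁))
    ≡⟨ cong (Maybe.map (shift (Vec.reverse Δ₂))) back₁ ⟩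
  just (Vec.reverse Δ₂ ⊕ Vec.reverse Δ₁ , Vec.reverse u)
    ≡⟨ cong (λ β → just (β , Vec.reverse u)) (trans (Vec.zipWith-comm +-comm _ _) (sym (reverse-zipWith _+_ Δ₁ Δ₂))) ⟩
  just (Vec.reverse (Δ₁ ⊕ Δ₂) , Vec.reverse u) ∎)
  where
  open ≡-Reasoning
  py₁ = proj₁ (act-reverse N k v pu v⊆ e₁)
  back₁ = proj₂ (act-reverse N k v pu v⊆ e₁)
  py : IsPerm N y
  py = subst (IsPerm N) (sym (step-swapVals N k o (zeroE N) y₁ e₂))
             (IsPerm-swapVals (a≢b o) (a>0 o , proj₁ o∈) (b>0 o , proj₂ o∈) y₁ py₁)

ρ-involutive : ∀ v → ρ (ρ v) ≡ v
ρ-involutive = List.reverse-involutive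

SuppIn-ρ : ∀ {N} v → SuppIn N (ρ v) → SuppIn N v
SuppIn-ρ v = All-resp-↭ (↭-reverse v)

0<k<n⇒0<n∸k<n : ∀ {N k} → 1 ≤ k → k < N → 1 ≤ N ∸ k × N ∸ k < N
0<k<n⇒0<n∸k<n {N} {k} 1≤k k<N = m<n⇒0<n∸m k<N , ∸-monoʳ-< {N} {k} {0} 1≤k (<⇒≤ k<N)

act-ρ-reverse : ∀ N k v {u Δ y} → IsPerm N u → SuppIn N (ρ v) → act N k (ρ v) (zeroE N , u) ≡ just (Δ , y) →
                IsPerm N y × act N (N ∸ k) v (zeroE N , Vec.reverse y) ≡ just (Vec.reverse Δ , Vec.reverse u)
act-ρ-reverse N k v pu ρv⊆ eq with act-reverse N k (ρ v) pu ρv⊆ eq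
... | py , back = py , subst (λ w → act N (N ∸ k) w _ ≡ _) (ρ-involutive v) back

act-ρ-unreverse : ∀ N k v {u Δ y} → k ≤ N → IsPerm N y → SuppIn N v →
                  act N (N ∸ k) v (zeroE N , Vec.reverse y) ≡ just (Vec.reverse Δ , Vec.reverse u) →
                  act N k (ρ v) (zeroE N , u) ≡ just (Δ , y)
act-ρ-unreverse N k v {u} {Δ} {y} k≤N py v⊆ eq
  with back ← proj₂ (act-reverse N (N ∸ k) v (IsPerm-reverse y py) v⊆ eq)
  rewrite m∸[m∸n]≡n k≤N | Vec.reverse-involutive u | Vec.reverse-involutive Δ | Vec.reverse-involutive y = back

just⇔just⇒≡ : ∀ {A : Set} {m m′ : Maybe A} → (∀ x → m ≡ just x → m′ ≡ just x) → (∀ x → m′ ≡ just x → m ≡ just x) → m ≡ m′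
just⇔just⇒≡ {m = just x}  m⇒m′ _ = sym (m⇒m′ x refl)
just⇔just⇒≡ {m = nothing} {m′ = nothing} _ _ = refl
just⇔just⇒≡ {m = nothing} {m′ = just x}  _ m′⇒m = m′⇒m x refl

≋𝟎-ρ : ∀ v → ≋𝟎 v → ≋𝟎 (ρ v)
≋𝟎-ρ v v≋𝟎 N ρv⊆ α u pu k 1≤k k<N rewrite act-shift N k (ρ v) α u with act N k (ρ v) (zeroE N , u) in eq
... | nothing     = refl
... | just (Δ , y) with py , back ← act-ρ-reverse N k v pu ρv⊆ eq
  with () ← trans (sym back) (v≋𝟎 N (SuppIn-ρ v ρv⊆) (zeroE N) (Vec.reverse y) (IsPerm-reverse y py) (N ∸ k)
                                  (proj₁ (0<k<n⇒0<n∸k<n 1≤k k<N)) (proj₂ (0<k<n⇒0<n∸k<n 1≤k k<N)))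

≋-sym : ∀ {v v′} → v ≋ v′ → v′ ≋ v
≋-sym v≋v′ N v′⊆ v⊆ α u pu k 1≤k k<N = sym (v≋v′ N v⊆ v′⊆ α u pu k 1≤k k<N)

-- A nonzero value of ρ v at u is read off, after reversal, from a value of v; so it is shared by every v′ ≋ v.
act-ρ-transfer : ∀ {v v′} → v ≋ v′ → ∀ N → SuppIn N (ρ v) → SuppIn N (ρ v′) → ∀ u → IsPerm N u →
                 ∀ k → 1 ≤ k → k < N → ∀ x → act N k (ρ v) (zeroE N , u) ≡ just x → act N k (ρ v′) (zeroE N , u) ≡ just x
act-ρ-transfer {v} {v′} v≋v′ N ρv⊆ ρv′⊆ u pu k 1≤k k<N (Δ , y) eq with py , back ← act-ρ-reverse N k v pu ρv⊆ eq =
  act-ρ-unreverse N k v′ (<⇒≤ k<N) py (SuppIn-ρ v′ ρv′⊆) (begin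
    act N (N ∸ k) v′ (zeroE N , Vec.reverse y)
      ≡⟨ v≋v′ N (SuppIn-ρ v ρv⊆) (SuppIn-ρ v′ ρv′⊆) (zeroE N) (Vec.reverse y) (IsPerm-reverse y py) (N ∸ k)
              (proj₁ (0<k<n⇒0<n∸k<n 1≤k k<N)) (proj₂ (0<k<n⇒0<n∸k<n 1≤k k<N)) ⟨
    act N (N ∸ k) v (zeroE N , Vec.reverse y)
      ≡⟨ back ⟩
    just (Vec.reverse Δ , Vec.reverse u) ∎)
  where open ≡-Reasoning

≋-ρ : ∀ v v′ → v ≋ v′ → ρ v ≋ ρ v′
≋-ρ v v′ v≋v′ N ρv⊆ ρv′⊆ α u pu k 1≤k k<N = begin
  act N k (ρ v) (α , u)                               ≡⟨ act-shift N k (ρ v) α u ⟩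
  Maybe.map (shift α) (act N k (ρ v) (zeroE N , u))   ≡⟨ cong (Maybe.map (shift α)) (just⇔just⇒≡
                                                           (act-ρ-transfer v≋v′ N ρv⊆ ρv′⊆ u pu k 1≤k k<N)
                                                           (act-ρ-transfer (≋-sym v≋v′) N ρv′⊆ ρv⊆ u pu k 1≤k k<N)) ⟩
  Maybe.map (shift α) (act N k (ρ v′) (zeroE N , u))  ≡⟨ act-shift N k (ρ v′) α u ⟨
  act N k (ρ v′) (α , u)                              ∎
  where open ≡-Reasoning

theorem5p28 : (v v' : Comp) →
    (≋𝟎 v ⇔ ≋𝟎 (ρ v)) × ((v ≋ v') ⇔ (ρ v ≋ ρ v'))
theorem5p28 v v' =
  mk⇔ (≋𝟎-ρ v) (λ ρv≋𝟎 → subst ≋𝟎 (ρ-involutive v) (≋𝟎-ρ (ρ v) ρv≋𝟎)) ,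
  mk⇔ (≋-ρ v v') (λ ρv≋ρv′ → subst₂ _≋_ (ρ-involutive v) (ρ-involutive v') (≋-ρ (ρ v) (ρ v') ρv≋ρv′))
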